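{- Let $(G_1,G_2,S)$ be a constrained alignment instance with $m_2=1$. Let $x_1,x_3$ be two non-conflicting $c_4$s that share neither a vertex nor an edge, and let $x_2$ be a $c_4$ that conflicts with both $x_1$ and $x_3$. Then $x_1,x_2,x_3$ are in chain configuration in the order $x_1,x_2,x_3$ (with $x_2$ in the middle).
   Context: Let $G_1=(V_1,E_1)$ and $G_2=(V_2,E_2)$ be finite simple undirected graphs with $V_1\cap V_2=\emptyset$, and let $S$ be a bipartite graph with parts $V_1,V_2$ in which every vertex of $V_1$ has degree at most $m_1$ and every vertex of $V_2$ has degree at most $m_2$; edges of $S$ are similarity edges. A $c_4$ is a 4-cycle $a-b-c-d-a$ in $G_1\cup G_2\cup S$ with $a,b\in V_1$, $c,d\in V_2$, $ab\in E_1$, $cd\in E_2$, $ad,bc\in E(S)$, regarded as a subgraph. Two distinct $c_4$s conflict if their similarity edges cannot all belong to a common matching of $S$. Sharing a vertex or edge is meant as subgraphs of $G_1\cup G_2\cup S$. A sequence of $c_4$s $y_1,\dots,y_k$ is in chain configuration (in this order) if for each $i<k$, $y_i$ and $y_{i+1}$ share exactly one vertex and that vertex lies in $V_1$, the vertex shared by $y_{i-1},y_i$ is different from the vertex shared by $y_i,y_{i+1}$, and $y_i,y_j$ share no vertex whenever $|i-j|\geq 2$. -}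

module Defs where

open import Level using (Level; _⊔_) renaming (suc to lsuc; zero to lzero)
open import Data.Nat using (ℕ; suc)
open import Data.Fin using (Fin; toℕ)
open import Data.Vec using (Vec; lookup)
open import Data.Product using (Σ; ∃; _×_; _,_)
open import Data.Sum using (_⊎_; inj₁; inj₂)
open import Relation.Nullary using (¬_)
open import Relation.Binary.PropositionalEquality using (_≡_; _≢_)

record SimpleGraph (n : ℕ) : Set₁ where
  field
    Adj      : Fin n → Fin n → Set
    symmetric   : ∀ {u v} → Adj u v → Adj v u
    irreflexive : ∀ {u} → ¬ Adj u u

-- An alignment instance (G₁, G₂, S): V₁ = Fin n₁, V₂ = Fin n₂ (disjoint,
-- realised as the two summands of Vtx below), S ⊆ V₁ × V₂ a bipartite graph.
record Instance : Set₁ where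
  field
    n₁ n₂ : ℕ
    G₁ : SimpleGraph n₁
    G₂ : SimpleGraph n₂
    S  : Fin n₁ → Fin n₂ → Set

-- Degree condition m₂ = 1: every vertex of V₂ has at most one S-neighbour.
DegV₂AtMostOne : Instance → Set
DegV₂AtMostOne I = ∀ {u u' : Fin n₁} {w : Fin n₂} → S u w → S u' w → u ≡ u'
  where open Instance I

module _ (I : Instance) where
  open Instance I
  open SimpleGraph

  Vtx : Set
  Vtx = Fin n₁ ⊎ Fin n₂

  record C4 : Set where
    constructor c4
    field
      a b : Fin n₁
      c d : Fin n₂
      ab∈E₁ : Adj G₁ a b
      cd∈E₂ : Adj G₂ c d
      ad∈S  : S a d
      bc∈S  : S b c

  open C4

  VertexOf : C4 → Vtx → Set
  VertexOf x v = (v ≡ inj₁ (a x)) ⊎ (v ≡ inj₁ (b x)) ⊎ (v ≡ inj₂ (c x)) ⊎ (v ≡ inj₂ (d x))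

  Arc : C4 → Vtx → Vtx → Set
  Arc x u v = (u ≡ inj₁ (a x) × v ≡ inj₁ (b x))
            ⊎ (u ≡ inj₁ (b x) × v ≡ inj₂ (c x))
            ⊎ (u ≡ inj₂ (c x) × v ≡ inj₂ (d x))
            ⊎ (u ≡ inj₂ (d x) × v ≡ inj₁ (a x))

  EdgeOf : C4 → Vtx → Vtx → Set
  EdgeOf x u v = Arc x u v ⊎ Arc x v u

  -- c4s are regarded as subgraphs: equal iff same vertex and edge sets
  SameSubgraph : C4 → C4 → Set
  SameSubgraph x y = (∀ v → (VertexOf x v → VertexOf y v) × (VertexOf y v → VertexOf x v))
                   × (∀ u v → (EdgeOf x u v → EdgeOf y u v) × (EdgeOf y u v → EdgeOf x u v))

  SharedVertex : C4 → C4 → Vtx → Set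
  SharedVertex x y v = VertexOf x v × VertexOf y v

  ShareVertex : C4 → C4 → Set
  ShareVertex x y = ∃ λ v → SharedVertex x y v

  ShareEdge : C4 → C4 → Set
  ShareEdge x y = ∃ λ u → ∃ λ v → EdgeOf x u v × EdgeOf y u v

  SimEdgeOf : C4 → Fin n₁ → Fin n₂ → Set
  SimEdgeOf x u w = (u ≡ a x × w ≡ d x) ⊎ (u ≡ b x × w ≡ c x)

  IsMatching : (Fin n₁ → Fin n₂ → Set) → Set
  IsMatching M = (∀ u w → M u w → S u w)
               × (∀ u w u' w' → M u w → M u' w' → (u ≡ u' × w ≡ w') ⊎ (u ≢ u' × w ≢ w'))

  Conflict : C4 → C4 → Set₁
  Conflict x y = ¬ SameSubgraph x y
               × ¬ (Σ (Fin n₁ → Fin n₂ → Set) λ M → IsMatching M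
                      × (∀ u w → SimEdgeOf x u w → M u w)
                      × (∀ u w → SimEdgeOf y u w → M u w))

  SharesExactlyV₁ : C4 → C4 → Fin n₁ → Set
  SharesExactlyV₁ x y v = SharedVertex x y (inj₁ v) × (∀ w → SharedVertex x y w → w ≡ inj₁ v)

  ChainConfiguration : ∀ {k} → Vec C4 k → Set
  ChainConfiguration {k} ys =
      (∀ (i j : Fin k) → toℕ j ≡ suc (toℕ i) →
         ∃ λ v → SharesExactlyV₁ (lookup ys i) (lookup ys j) v)
    × (∀ (h i j : Fin k) → toℕ i ≡ suc (toℕ h) → toℕ j ≡ suc (toℕ i) →
         ∀ v w → SharedVertex (lookup ys h) (lookup ys i) v
               → SharedVertex (lookup ys i) (lookup ys j) w → v ≢ w)
    × (∀ (i j : Fin k) → suc (suc (toℕ i)) Data.Nat.≤ toℕ j →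
         ¬ ShareVertex (lookup ys i) (lookup ys j))

-- When m₂ = 1, two c4s x, y conflict exactly when some V₁-vertex u carries a
-- similarity edge of x and one of y with different V₂-ends: any other
-- obstruction to a common matching would be a V₂-vertex with two S-neighbours.
-- So x₂ conflicts with x₁ at one of its V₁-vertices u and with x₃ at one u',
-- lying in x₁ and x₃ respectively; as x₁, x₃ are disjoint, u ≠ u' and these are
-- the two V₁-vertices of x₂. A shared V₂-vertex w of x₁ and x₂ would, again by
-- m₂ = 1, give a similarity edge (t, w) common to both, with t ∈ x₁ ∩ x₂ forcing
-- t = u; but at u the two c4s use different similarity edges.
module Submission where

open import Defs
open import Data.Vec using (Vec; _∷_; []; lookup)
open import Data.Nat using (suc; s≤s; _≤_)
open import Data.Fin using (Fin; zero; suc; toℕ; _≟_)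
open import Data.Fin.Properties using (any?)
open import Data.Product using (∃; _×_; _,_; proj₁; proj₂; swap)
open import Data.Sum using (_⊎_; inj₁; inj₂; [_,_]′)
open import Data.Empty using (⊥-elim)
open import Function using (_∘_; id)
open import Relation.Nullary using (¬_; Dec; yes; no; ¬?)
open import Relation.Nullary.Decidable using (_×-dec_; _⊎-dec_; decidable-stable)
open import Relation.Unary using (Decidable)
open import Relation.Binary.PropositionalEquality using (_≡_; _≢_; refl; sym; trans; cong; subst)

≡-either-of-two : ∀ {A : Set} {p q t u u' : A} →
                  t ≡ p ⊎ t ≡ q → u ≡ p ⊎ u ≡ q → u' ≡ p ⊎ u' ≡ q → u ≢ u' →
                  t ≡ u ⊎ t ≡ u'
≡-either-of-two (inj₁ refl) (inj₁ refl) _           _    = inj₁ refl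
≡-either-of-two (inj₁ refl) (inj₂ refl) (inj₁ refl) _    = inj₂ refl
≡-either-of-two (inj₁ refl) (inj₂ refl) (inj₂ refl) u≢u' = ⊥-elim (u≢u' refl)
≡-either-of-two (inj₂ refl) (inj₂ refl) _           _    = inj₁ refl
≡-either-of-two (inj₂ refl) (inj₁ refl) (inj₂ refl) _    = inj₂ refl
≡-either-of-two (inj₂ refl) (inj₁ refl) (inj₁ refl) u≢u' = ⊥-elim (u≢u' refl)

module Conflicts (I : Instance) where
  open Instance I
  open SimpleGraph
  open C4

  a≢b : ∀ (x : C4 I) → a x ≢ b x
  a≢b x a≡b = irreflexive G₁ (subst (Adj G₁ (a x)) (sym a≡b) (ab∈E₁ x))

  ShareVertex-sym : ∀ (x y : C4 I) → ShareVertex I x y → ShareVertex I y x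
  ShareVertex-sym x y (v , s) = v , swap s

  SharesExactlyV₁-sym : ∀ (x y : C4 I) {v} → SharesExactlyV₁ I x y v → SharesExactlyV₁ I y x v
  SharesExactlyV₁-sym x y (s , only) = swap s , λ w s' → only w (swap s')

  V₁-vertex : ∀ (x : C4 I) {t} → VertexOf I x (inj₁ t) → t ≡ a x ⊎ t ≡ b x
  V₁-vertex x (inj₁ refl)                = inj₁ refl
  V₁-vertex x (inj₂ (inj₁ refl))         = inj₂ refl
  V₁-vertex x (inj₂ (inj₂ (inj₁ ())))
  V₁-vertex x (inj₂ (inj₂ (inj₂ ())))

  simEdge? : ∀ (x : C4 I) u w → Dec (SimEdgeOf I x u w)
  simEdge? x u w = (u ≟ a x ×-dec w ≟ d x) ⊎-dec (u ≟ b x ×-dec w ≟ c x)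

  simEdge⇒S : ∀ (x : C4 I) {u w} → SimEdgeOf I x u w → S u w
  simEdge⇒S x (inj₁ (refl , refl)) = ad∈S x
  simEdge⇒S x (inj₂ (refl , refl)) = bc∈S x

  simEdge⇒V₁-vertex : ∀ (x : C4 I) {u w} → SimEdgeOf I x u w → VertexOf I x (inj₁ u)
  simEdge⇒V₁-vertex x (inj₁ (refl , _)) = inj₁ refl
  simEdge⇒V₁-vertex x (inj₂ (refl , _)) = inj₂ (inj₁ refl)

  V₂-vertex⇒simEdge : ∀ (x : C4 I) {w} → VertexOf I x (inj₂ w) → ∃ λ t → SimEdgeOf I x t w
  V₂-vertex⇒simEdge x (inj₁ ())
  V₂-vertex⇒simEdge x (inj₂ (inj₁ ()))
  V₂-vertex⇒simEdge x (inj₂ (inj₂ (inj₁ refl))) = b x , inj₂ (refl , refl)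
  V₂-vertex⇒simEdge x (inj₂ (inj₂ (inj₂ refl))) = a x , inj₁ (refl , refl)

  simEdge-functional : ∀ (x : C4 I) {u w w'} → SimEdgeOf I x u w → SimEdgeOf I x u w' → w ≡ w'
  simEdge-functional x (inj₁ (refl , refl)) (inj₁ (_ , refl))   = refl
  simEdge-functional x (inj₂ (refl , refl)) (inj₂ (_ , refl))   = refl
  simEdge-functional x (inj₁ (refl , _))    (inj₂ (a≡b , _))    = ⊥-elim (a≢b x a≡b)
  simEdge-functional x (inj₂ (refl , _))    (inj₁ (b≡a , _))    = ⊥-elim (a≢b x (sym b≡a))

  ConflictAt : C4 I → C4 I → Fin n₁ → Set
  ConflictAt x y u = ∃ λ w → ∃ λ w' → SimEdgeOf I x u w × SimEdgeOf I y u w' × w ≢ w'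

  conflictAt? : ∀ (x y : C4 I) → Decidable (ConflictAt x y)
  conflictAt? x y u =
    any? λ w → any? λ w' → simEdge? x u w ×-dec simEdge? y u w' ×-dec ¬? (w ≟ w')

  conflictAt⇒sharedVertex : ∀ (x y : C4 I) {u} → ConflictAt x y u → SharedVertex I x y (inj₁ u)
  conflictAt⇒sharedVertex x y (_ , _ , e , e' , _) =
    simEdge⇒V₁-vertex x e , simEdge⇒V₁-vertex y e'

  conflictAt⇒¬commonSimEdge : ∀ (x y : C4 I) {u w} → ConflictAt x y u →
                              ¬ (SimEdgeOf I x u w × SimEdgeOf I y u w)
  conflictAt⇒¬commonSimEdge x y (_ , _ , ex , ey , w≢w') (e , e') =
    w≢w' (trans (simEdge-functional x ex e) (simEdge-functional y e' ey))

  sharedV₁-unique : ∀ (x y z : C4 I) {u u'} → ConflictAt y x u → ConflictAt y z u' →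
                    ¬ ShareVertex I x z →
                    ∀ {t} → SharedVertex I y x (inj₁ t) → t ≡ u
  sharedV₁-unique x y z {u} {u'} k k' disjoint {t} (ty , tx) =
    [ id , ⊥-elim ∘ t≢u' ]′
      (≡-either-of-two (V₁-vertex y ty) (V₁-vertex y u∈y) (V₁-vertex y u'∈y) u≢u')
    where
    u∈y : VertexOf I y (inj₁ u)
    u∈y = proj₁ (conflictAt⇒sharedVertex y x k)
    u∈x : VertexOf I x (inj₁ u)
    u∈x = proj₂ (conflictAt⇒sharedVertex y x k)
    u'∈y : VertexOf I y (inj₁ u')
    u'∈y = proj₁ (conflictAt⇒sharedVertex y z k')
    u'∈z : VertexOf I z (inj₁ u')
    u'∈z = proj₂ (conflictAt⇒sharedVertex y z k')
    u≢u' : u ≢ u'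
    u≢u' refl = disjoint (inj₁ u , u∈x , u'∈z)
    t≢u' : t ≢ u'
    t≢u' refl = disjoint (inj₁ t , tx , u'∈z)

  chainConfiguration₃ : ∀ (x y z : C4 I) {v v'} →
                        SharesExactlyV₁ I x y v → SharesExactlyV₁ I y z v' →
                        ¬ ShareVertex I x z → ChainConfiguration I (x ∷ y ∷ z ∷ [])
  chainConfiguration₃ x y z {v} {v'} xy yz disjoint = consecutive , distinctJoints , farApart
    where
    xyz : Vec (C4 I) 3
    xyz = x ∷ y ∷ z ∷ []
    consecutive : ∀ i j → toℕ j ≡ suc (toℕ i) →
                  ∃ λ w → SharesExactlyV₁ I (lookup xyz i) (lookup xyz j) w
    consecutive zero (suc zero) refl = v , xy
    consecutive (suc zero) (suc (suc zero)) refl = v' , yz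
    consecutive zero zero ()
    consecutive zero (suc (suc zero)) ()
    consecutive (suc _) zero ()
    consecutive (suc zero) (suc zero) ()
    consecutive (suc (suc zero)) (suc zero) ()
    consecutive (suc (suc zero)) (suc (suc zero)) ()
    distinctJoints : ∀ h i j → toℕ i ≡ suc (toℕ h) → toℕ j ≡ suc (toℕ i) → ∀ w w' →
                     SharedVertex I (lookup xyz h) (lookup xyz i) w →
                     SharedVertex I (lookup xyz i) (lookup xyz j) w' → w ≢ w'
    distinctJoints zero (suc zero) (suc (suc zero)) refl refl w _ (wx , _) (_ , wz) refl =
      disjoint (w , wx , wz)
    distinctJoints zero zero _ () _
    distinctJoints zero (suc (suc zero)) _ () _
    distinctJoints zero (suc zero) zero _ ()
    distinctJoints zero (suc zero) (suc zero) _ ()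
    distinctJoints (suc zero) zero _ () _
    distinctJoints (suc zero) (suc zero) _ () _
    distinctJoints (suc zero) (suc (suc zero)) zero _ ()
    distinctJoints (suc zero) (suc (suc zero)) (suc zero) _ ()
    distinctJoints (suc zero) (suc (suc zero)) (suc (suc zero)) _ ()
    distinctJoints (suc (suc zero)) zero _ () _
    distinctJoints (suc (suc zero)) (suc zero) _ () _
    distinctJoints (suc (suc zero)) (suc (suc zero)) _ () _
    farApart : ∀ i j → suc (suc (toℕ i)) ≤ toℕ j →
               ¬ ShareVertex I (lookup xyz i) (lookup xyz j)
    farApart zero (suc (suc zero)) _ = disjoint
    farApart zero zero ()
    farApart zero (suc zero) (s≤s ())
    farApart (suc zero) zero ()
    farApart (suc zero) (suc zero) (s≤s ())
    farApart (suc zero) (suc (suc zero)) (s≤s (s≤s ()))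
    farApart (suc (suc zero)) zero ()
    farApart (suc (suc zero)) (suc zero) (s≤s ())
    farApart (suc (suc zero)) (suc (suc zero)) (s≤s (s≤s ()))

  simEdgesUnion : C4 I → C4 I → Fin n₁ → Fin n₂ → Set
  simEdgesUnion x y u w = SimEdgeOf I x u w ⊎ SimEdgeOf I y u w

  module _ (deg : DegV₂AtMostOne I) where

    sharedV₂⇒commonSimEdge : ∀ (x y : C4 I) {w} → VertexOf I x (inj₂ w) → VertexOf I y (inj₂ w) →
                             ∃ λ t → SimEdgeOf I x t w × SimEdgeOf I y t w
    sharedV₂⇒commonSimEdge x y wx wy
      with V₂-vertex⇒simEdge x wx | V₂-vertex⇒simEdge y wy
    ... | t , e | t' , e' with deg (simEdge⇒S x e) (simEdge⇒S y e')
    ...   | refl = t , e , e'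

    simEdgesUnion-isMatching : ∀ (x y : C4 I) → (∀ u → ¬ ConflictAt x y u) →
                               IsMatching I (simEdgesUnion x y)
    simEdgesUnion-isMatching x y noConflict = (λ _ _ → ∈S) , disjointOrEqual
      where
      ∈S : ∀ {u w} → simEdgesUnion x y u w → S u w
      ∈S (inj₁ e) = simEdge⇒S x e
      ∈S (inj₂ e) = simEdge⇒S y e
      functional : ∀ {u w w'} → simEdgesUnion x y u w → simEdgesUnion x y u w' → w ≡ w'
      functional (inj₁ e) (inj₁ e') = simEdge-functional x e e'
      functional (inj₂ e) (inj₂ e') = simEdge-functional y e e'
      functional {u} {w} {w'} (inj₁ e) (inj₂ e') =
        decidable-stable (w ≟ w') λ w≢w' → noConflict u (w , w' , e , e' , w≢w')
      functional {u} {w} {w'} (inj₂ e) (inj₁ e') =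
        decidable-stable (w ≟ w') λ w≢w' → noConflict u (w' , w , e' , e , w≢w' ∘ sym)
      disjointOrEqual : ∀ u w u' w' → simEdgesUnion x y u w → simEdgesUnion x y u' w' →
                        (u ≡ u' × w ≡ w') ⊎ (u ≢ u' × w ≢ w')
      disjointOrEqual u w u' w' e e' with u ≟ u' | w ≟ w'
      ... | yes u≡u' | yes w≡w' = inj₁ (u≡u' , w≡w')
      ... | no u≢u'  | no w≢w'  = inj₂ (u≢u' , w≢w')
      ... | no u≢u'  | yes refl = ⊥-elim (u≢u' (deg (∈S e) (∈S e')))
      ... | yes refl | no w≢w'  = ⊥-elim (w≢w' (functional e e'))

    conflict⇒conflictAt : ∀ (x y : C4 I) → Conflict I x y → ∃ (ConflictAt x y)
    conflict⇒conflictAt x y (_ , noCommonMatching) =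
      decidable-stable (any? (conflictAt? x y)) λ noConflict →
        noCommonMatching
          ( simEdgesUnion x y
          , simEdgesUnion-isMatching x y (λ u k → noConflict (u , k))
          , (λ _ _ → inj₁) , (λ _ _ → inj₂))

    conflictAt⇒sharesExactlyV₁ : ∀ (x y : C4 I) {u} → ConflictAt y x u →
                                 (∀ {t} → SharedVertex I y x (inj₁ t) → t ≡ u) →
                                 SharesExactlyV₁ I y x u
    conflictAt⇒sharesExactlyV₁ x y {u} k unique = conflictAt⇒sharedVertex y x k , onlyU
      where
      onlyU : ∀ v → SharedVertex I y x v → v ≡ inj₁ u
      onlyU (inj₁ t) s = cong inj₁ (unique s)
      onlyU (inj₂ w) (wy , wx) with sharedV₂⇒commonSimEdge y x wy wx
      ... | t , ey , ex with unique (simEdge⇒V₁-vertex y ey , simEdge⇒V₁-vertex x ex)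
      ...   | refl = ⊥-elim (conflictAt⇒¬commonSimEdge y x k (ey , ex))

lemma2 : (I : Instance) → DegV₂AtMostOne I →
         (x₁ x₂ x₃ : C4 I) →
         ¬ Conflict I x₁ x₃ → ¬ ShareVertex I x₁ x₃ → ¬ ShareEdge I x₁ x₃ →
         Conflict I x₂ x₁ → Conflict I x₂ x₃ →
         ChainConfiguration I (x₁ ∷ x₂ ∷ x₃ ∷ [])
lemma2 I deg x₁ x₂ x₃ _ disjoint _ k₁ k₃ =
  let open Conflicts I
      (_ , c₁) = conflict⇒conflictAt deg x₂ x₁ k₁
      (_ , c₃) = conflict⇒conflictAt deg x₂ x₃ k₃
  in chainConfiguration₃ x₁ x₂ x₃
       (SharesExactlyV₁-sym x₂ x₁
         (conflictAt⇒sharesExactlyV₁ deg x₁ x₂ c₁ (sharedV₁-unique x₁ x₂ x₃ c₁ c₃ disjoint)))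
       (conflictAt⇒sharesExactlyV₁ deg x₃ x₂ c₃
         (sharedV₁-unique x₃ x₂ x₁ c₃ c₁ (disjoint ∘ ShareVertex-sym x₃ x₁)))
       disjoint
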